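{- Let $V=\{i,j,k\}$ and let $A=(a_{xy})_{x,y\in V}$, $B=(b_{xy})_{x,y\in V}$ be two dense skew-symmetric matrices such that $a_{ij}=b_{ij}$, $a_{ki}=b_{ik}$ and $a_{kj}=b_{jk}$. If $\det(A^{\infty})=\det(B^{\infty})$, then $a_{ik}=a_{jk}$ and $b_{ik}=b_{jk}$.
   Context: Throughout, matrices have entries in a field $\mathbb{K}$ of characteristic not equal to $2$. A matrix is dense if all its off-diagonal entries are nonzero. For a dense skew-symmetric matrix $A=(a_{xy})_{x,y\in V}$, let $V^{\infty}:=V\cup\{\infty\}$ (with $\infty\notin V$) and let $A^{\infty}=(a_{xy})_{x,y\in V^{\infty}}$ extend $A$ by $a_{\infty\infty}=0$, $a_{\infty y}=1$ and $a_{y\infty}=-1$ for $y\in V$. -}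

module Defs where

open import Level using (Level; _⊔_)
open import Algebra.Bundles using (CommutativeRing)
open import Data.Nat using (ℕ; zero; suc)
open import Data.Fin using (Fin; zero; suc; punchIn)
open import Data.Product using (∃)
open import Relation.Nullary using (¬_)

record Field (c ℓ : Level) : Set (Level.suc (c ⊔ ℓ)) where
  field
    commutativeRing : CommutativeRing c ℓ
  open CommutativeRing commutativeRing public
  field
    1≉0     : ¬ (1# ≈ 0#)
    inverse : ∀ x → ¬ (x ≈ 0#) → ∃ λ y → x * y ≈ 1#

module FieldDefs {c ℓ : Level} (K : Field c ℓ) where
  open Field K public using (Carrier; _≈_; _+_; _*_; -_; 0#; 1#)

  CharNot2 : Set ℓ
  CharNot2 = ¬ (1# + 1# ≈ 0#)

  Matrix : ℕ → Set c
  Matrix n = Fin n → Fin n → Carrier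

  SkewSymmetric : ∀ {n} → Matrix n → Set ℓ
  SkewSymmetric {n} M = ∀ (x y : Fin n) → M y x ≈ - M x y

  Dense : ∀ {n} → Matrix n → Set ℓ
  Dense {n} M = ∀ (x y : Fin n) → ¬ (x ≡ y) → ¬ (M x y ≈ 0#)
    where open import Relation.Binary.PropositionalEquality using (_≡_)

  Σ : ∀ n → (Fin n → Carrier) → Carrier
  Σ zero    f = 0#
  Σ (suc n) f = f zero + Σ n (λ i → f (suc i))

  signed : ∀ {n} → Fin n → Carrier → Carrier
  signed zero    x = x
  signed (suc i) x = - signed i x

  minor : ∀ {n} → Matrix (suc n) → Fin (suc n) → Matrix n
  minor M j r s = M (suc r) (punchIn j s)

  det : ∀ n → Matrix n → Carrier
  det zero    M = 1#
  det (suc n) M = Σ (suc n) (λ j → signed j (M zero j * det n (minor M j)))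

  -- A^∞ : the index 'zero' plays the role of ∞, 'suc x' the role of x ∈ V
  _^∞ : ∀ {n} → Matrix n → Matrix (suc n)
  (M ^∞) zero    zero    = 0#
  (M ^∞) zero    (suc y) = 1#
  (M ^∞) (suc x) zero    = - 1#
  (M ^∞) (suc x) (suc y) = M x y

module Submission where

-- For a skew-symmetric A on V = {i,j,k} write a = a_ij, b = a_ik,
-- c = a_jk.  The matrix A^∞ is a 4×4 skew-symmetric matrix, so its determinant is
-- the square of its Pfaffian:  det(A^∞) = (a - b + c)².  The hypotheses say that
-- B has b_ij = a, b_ik = -b, b_jk = -c, hence det(B^∞) = (a + b - c)².  Since
--   (a - b + c)² - (a + b - c)² = 4·a·(c - b),
-- equality of the determinants, a ≠ 0 (density) and 2 ≠ 0 give b = c, i.e.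
-- a_ik = a_jk, and then b_ik = -b = -c = b_jk.

open import Defs
open import Algebra.Bundles using (CommutativeRing; RawRing)
open import Data.Nat as ℕ using (zero; suc)
open import Data.Nat.Properties using (+-suc)
open import Data.Fin using (Fin; zero; suc; punchIn)
open import Data.Integer as ℤ using (ℤ; +_; -[1+_]; _⊖_; _◃_; sign; ∣_∣)
open import Data.Integer.Properties using ([1+m]⊖[1+n]≡m⊖n)
open import Data.Sign as Sign using (Sign)
open import Data.Maybe using (Maybe; just; nothing)
open import Data.Product using (_×_; _,_)
open import Relation.Nullary using (¬_; yes; no)
open import Relation.Binary.PropositionalEquality using (_≡_; cong)

ℤ-rawRing : RawRing _ _
ℤ-rawRing = record
  { Carrier = ℤ ; _≈_ = _≡_ ; _+_ = ℤ._+_ ; _*_ = ℤ._*_ ; -_ = ℤ.-_ ; 0# = + 0 ; 1# = + 1 }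

module IntegerCoefficients {c ℓ} (R : CommutativeRing c ℓ) where
  open CommutativeRing R
  open import Algebra.Properties.Ring ring using (-0#≈0#; -‿involutive; -‿+-comm; -‿distribˡ-*; -‿distribʳ-*)
  open import Algebra.Properties.Semiring.Mult.TCOptimised semiring using (1+×; ×-homo-+; ×1-homo-*) renaming (_×_ to _×ᴿ_)
  open import Algebra.Solver.Ring.AlmostCommutativeRing using (fromCommutativeRing; _-Raw-AlmostCommutative⟶_)
  open import Relation.Binary.Reasoning.Setoid setoid

  applySign : Sign → Carrier → Carrier
  applySign Sign.+ x = x
  applySign Sign.- x = - x

  applySign-cong : ∀ s {x y} → x ≈ y → applySign s x ≈ applySign s y
  applySign-cong Sign.+ x≈y = x≈y
  applySign-cong Sign.- x≈y = -‿cong x≈y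

  applySign-* : ∀ s t x y → applySign (s Sign.* t) (x * y) ≈ applySign s x * applySign t y
  applySign-* Sign.+ Sign.+ x y = refl
  applySign-* Sign.+ Sign.- x y = -‿distribʳ-* x y
  applySign-* Sign.- Sign.+ x y = -‿distribˡ-* x y
  applySign-* Sign.- Sign.- x y = begin
    x * y         ≈⟨ -‿involutive (x * y) ⟨
    - - (x * y)   ≈⟨ -‿cong (-‿distribˡ-* x y) ⟩
    - (- x * y)   ≈⟨ -‿distribʳ-* (- x) y ⟩
    - x * - y     ∎

  -- The canonical map ℤ → R:  i ↦ sign(i) · (|i| · 1).  For TCOptimised
  -- multiplication 0 ↦ 0# and 1 ↦ 1# hold definitionally.
  ι : ℤ → Carrier
  ι i = applySign (sign i) (∣ i ∣ ×ᴿ 1#)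

  [z+x]-[z+y] : ∀ z x y → (z + x) - (z + y) ≈ x - y
  [z+x]-[z+y] z x y = begin
    (z + x) + - (z + y)     ≈⟨ +-congˡ (-‿+-comm z y) ⟨
    (z + x) + (- z + - y)   ≈⟨ +-congʳ (+-comm z x) ⟩
    (x + z) + (- z + - y)   ≈⟨ +-assoc x z _ ⟩
    x + (z + (- z + - y))   ≈⟨ +-congˡ (+-assoc z (- z) (- y)) ⟨
    x + ((z + - z) + - y)   ≈⟨ +-congˡ (+-congʳ (-‿inverseʳ z)) ⟩
    x + (0# + - y)          ≈⟨ +-congˡ (+-identityˡ (- y)) ⟩
    x + - y                 ∎

  -- ι on a difference of naturals, the case of addition with mixed signs.
  ι-⊖ : ∀ m n → ι (m ⊖ n) ≈ m ×ᴿ 1# - n ×ᴿ 1#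
  ι-⊖ zero    zero    = sym (trans (+-congˡ -0#≈0#) (+-identityʳ 0#))
  ι-⊖ (suc m) zero    = sym (trans (+-congˡ -0#≈0#) (+-identityʳ _))
  ι-⊖ zero    (suc n) = sym (+-identityˡ _)
  ι-⊖ (suc m) (suc n) = begin
    ι (suc m ⊖ suc n)                  ≡⟨ cong ι ([1+m]⊖[1+n]≡m⊖n m n) ⟩
    ι (m ⊖ n)                          ≈⟨ ι-⊖ m n ⟩
    m ×ᴿ 1# - n ×ᴿ 1#                  ≈⟨ [z+x]-[z+y] 1# (m ×ᴿ 1#) (n ×ᴿ 1#) ⟨
    (1# + m ×ᴿ 1#) - (1# + n ×ᴿ 1#)    ≈⟨ +-cong (1+× m 1#) (-‿cong (1+× n 1#)) ⟨
    suc m ×ᴿ 1# - suc n ×ᴿ 1#          ∎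

  ι-+ : ∀ i j → ι (i ℤ.+ j) ≈ ι i + ι j
  ι-+ (+ m)    (+ n)    = ×-homo-+ 1# m n
  ι-+ (+ m)    -[1+ n ] = ι-⊖ m (suc n)
  ι-+ -[1+ m ] (+ n)    = trans (ι-⊖ n (suc m)) (+-comm _ _)
  ι-+ -[1+ m ] -[1+ n ] = begin
    - (suc (suc (m ℕ.+ n)) ×ᴿ 1#)       ≡⟨ cong (λ k → - (suc k ×ᴿ 1#)) (+-suc m n) ⟨
    - ((suc m ℕ.+ suc n) ×ᴿ 1#)         ≈⟨ -‿cong (×-homo-+ 1# (suc m) (suc n)) ⟩
    - (suc m ×ᴿ 1# + suc n ×ᴿ 1#)       ≈⟨ -‿+-comm _ _ ⟨
    - (suc m ×ᴿ 1#) + - (suc n ×ᴿ 1#)   ∎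

  -- Integer multiplication is defined through _◃_ (sign and magnitude).
  ι-◃ : ∀ s n → ι (s ◃ n) ≈ applySign s (n ×ᴿ 1#)
  ι-◃ Sign.+ zero    = refl
  ι-◃ Sign.- zero    = sym -0#≈0#
  ι-◃ Sign.+ (suc n) = refl
  ι-◃ Sign.- (suc n) = refl

  ι-* : ∀ i j → ι (i ℤ.* j) ≈ ι i * ι j
  ι-* i j = begin
    ι (sign i Sign.* sign j ◃ ∣ i ∣ ℕ.* ∣ j ∣)                         ≈⟨ ι-◃ (sign i Sign.* sign j) (∣ i ∣ ℕ.* ∣ j ∣) ⟩
    applySign (sign i Sign.* sign j) ((∣ i ∣ ℕ.* ∣ j ∣) ×ᴿ 1#)         ≈⟨ applySign-cong (sign i Sign.* sign j) (×1-homo-* ∣ i ∣ ∣ j ∣) ⟩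
    applySign (sign i Sign.* sign j) ((∣ i ∣ ×ᴿ 1#) * (∣ j ∣ ×ᴿ 1#)) ≈⟨ applySign-* (sign i) (sign j) _ _ ⟩
    ι i * ι j                                                          ∎

  ι-neg : ∀ i → ι (ℤ.- i) ≈ - ι i
  ι-neg (+ zero)  = sym -0#≈0#
  ι-neg (+ suc n) = refl
  ι-neg -[1+ n ]  = sym (-‿involutive _)

  -- Hence integer polynomial identities hold in R: the stdlib solver applies.
  ι-homomorphism : ℤ-rawRing -Raw-AlmostCommutative⟶ fromCommutativeRing R
  ι-homomorphism = record
    { ⟦_⟧ = ι ; +-homo = ι-+ ; *-homo = ι-* ; -‿homo = ι-neg ; 0-homo = refl ; 1-homo = refl }

  ι-equal? : ∀ i j → Maybe (ι i ≈ ι j)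
  ι-equal? i j with i ℤ.≟ j
  ... | yes i≡j = just (reflexive (cong ι i≡j))
  ... | no _    = nothing

  open import Algebra.Solver.Ring ℤ-rawRing (fromCommutativeRing R) ι-homomorphism ι-equal? public

-- The skew-symmetric 3×3 and 4×4 matrices with prescribed entries above the
-- diagonal, over any carrier with a zero and a negation (skew4 is used both for
-- field elements and for symbolic polynomials).
skew3 : ∀ {a} {A : Set a} → A → (A → A) → (x y z : A) → Fin 3 → Fin 3 → A
skew3 o neg x y z zero             zero             = o
skew3 o neg x y z zero             (suc zero)       = x
skew3 o neg x y z zero             (suc (suc zero)) = y
skew3 o neg x y z (suc zero)       zero             = neg x
skew3 o neg x y z (suc zero)       (suc zero)       = o
skew3 o neg x y z (suc zero)       (suc (suc zero)) = z
skew3 o neg x y z (suc (suc zero)) zero             = neg y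
skew3 o neg x y z (suc (suc zero)) (suc zero)       = neg z
skew3 o neg x y z (suc (suc zero)) (suc (suc zero)) = o

skew4 : ∀ {a} {A : Set a} → A → (A → A) → (u v w x y z : A) → Fin 4 → Fin 4 → A
skew4 o neg u v w x y z zero                   zero                   = o
skew4 o neg u v w x y z zero                   (suc zero)             = u
skew4 o neg u v w x y z zero                   (suc (suc zero))       = v
skew4 o neg u v w x y z zero                   (suc (suc (suc zero))) = w
skew4 o neg u v w x y z (suc zero)             zero                   = neg u
skew4 o neg u v w x y z (suc zero)             (suc zero)             = o
skew4 o neg u v w x y z (suc zero)             (suc (suc zero))       = x
skew4 o neg u v w x y z (suc zero)             (suc (suc (suc zero))) = y
skew4 o neg u v w x y z (suc (suc zero))       zero                   = neg v
skew4 o neg u v w x y z (suc (suc zero))       (suc zero)             = neg x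
skew4 o neg u v w x y z (suc (suc zero))       (suc (suc zero))       = o
skew4 o neg u v w x y z (suc (suc zero))       (suc (suc (suc zero))) = z
skew4 o neg u v w x y z (suc (suc (suc zero))) zero                   = neg w
skew4 o neg u v w x y z (suc (suc (suc zero))) (suc zero)             = neg y
skew4 o neg u v w x y z (suc (suc (suc zero))) (suc (suc zero))       = neg z
skew4 o neg u v w x y z (suc (suc (suc zero))) (suc (suc (suc zero))) = o

module SkewDeterminants {c ℓ} (K : Field c ℓ) where
  open FieldDefs K
  open Field K using (commutativeRing; _-_; refl; sym; trans; +-cong; *-cong; -‿cong; +-congˡ;
                      *-congˡ; *-congʳ; *-comm; *-assoc; *-identityˡ; zeroʳ; -‿inverseʳ; inverse)
  open IntegerCoefficients commutativeRing using (Polynomial; con; _:+_; _:*_; :-_; _:-_; solve; _:=_)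
  open import Algebra.Properties.Ring (Field.ring K) using (x∙y⁻¹≈ε⇒x≈y; x≈y⇒x∙y⁻¹≈ε)
  open import Relation.Binary.Reasoning.Setoid (Field.setoid K)

  _≐_ : ∀ {n} → Matrix n → Matrix n → Set ℓ
  M ≐ N = ∀ r s → M r s ≈ N r s

  Σ-cong : ∀ n {f g : Fin n → Carrier} → (∀ i → f i ≈ g i) → Σ n f ≈ Σ n g
  Σ-cong zero    f≈g = refl
  Σ-cong (suc n) f≈g = +-cong (f≈g zero) (Σ-cong n (λ i → f≈g (suc i)))

  signed-cong : ∀ {n} (i : Fin n) {x y} → x ≈ y → signed i x ≈ signed i y
  signed-cong zero    x≈y = x≈y
  signed-cong (suc i) x≈y = -‿cong (signed-cong i x≈y)

  det-cong : ∀ n {M N : Matrix n} → M ≐ N → det n M ≈ det n N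
  det-cong zero    M≐N = refl
  det-cong (suc n) M≐N = Σ-cong (suc n) λ j →
    signed-cong j (*-cong (M≐N zero j) (det-cong n (λ r s → M≐N (suc r) (punchIn j s))))

  ^∞-cong : ∀ {n} {M N : Matrix n} → M ≐ N → (M ^∞) ≐ (N ^∞)
  ^∞-cong M≐N zero    zero    = refl
  ^∞-cong M≐N zero    (suc s) = refl
  ^∞-cong M≐N (suc r) zero    = refl
  ^∞-cong M≐N (suc r) (suc s) = M≐N r s

  -- A copy of det acting on matrices of polynomials; evaluating it unfolds
  -- definitionally to det of the evaluated matrix, which lets the ring solver
  -- see a determinant as a polynomial.
  Σₚ : ∀ {k} m → (Fin m → Polynomial k) → Polynomial k
  Σₚ zero    f = con (+ 0)
  Σₚ (suc m) f = f zero :+ Σₚ m (λ i → f (suc i))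

  signedₚ : ∀ {k m} → Fin m → Polynomial k → Polynomial k
  signedₚ zero    p = p
  signedₚ (suc i) p = :- signedₚ i p

  detₚ : ∀ {k} m → (Fin m → Fin m → Polynomial k) → Polynomial k
  detₚ zero    P = con (+ 1)
  detₚ (suc m) P = Σₚ (suc m) λ j →
    signedₚ j (P zero j :* detₚ m (λ r s → P (suc r) (punchIn j s)))

  sq : Carrier → Carrier
  sq x = x * x

  pfaffian4 : ∀ u v w x y z → det 4 (skew4 0# -_ u v w x y z) ≈ sq (u * z - v * y + w * x)
  pfaffian4 = solve 6 (λ u v w x y z →
    detₚ 4 (skew4 (con (+ 0)) :-_ u v w x y z) := (u :* z :- v :* y :+ w :* x) :* (u :* z :- v :* y :+ w :* x)) refl

  -- (skew3 a b c)^∞ is, entry by entry and definitionally, skew4 with u = v = w = 1,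
  -- so its determinant is (1·c - 1·b + 1·a)² = (a - b + c)².
  det-skew3^∞ : ∀ a b c → det 4 (skew3 0# -_ a b c ^∞) ≈ sq (a - b + c)
  det-skew3^∞ a b c = trans (pfaffian4 1# 1# 1# a b c) (*-cong pf≈ pf≈)
    where
    pf≈ : 1# * c - 1# * b + 1# * a ≈ a - b + c
    pf≈ = solve 3 (λ a b c → con (+ 1) :* c :- con (+ 1) :* b :+ con (+ 1) :* a := a :- b :+ c) refl a b c

  cancel : ∀ {x y} → ¬ (x ≈ 0#) → x * y ≈ 0# → y ≈ 0#
  cancel {x} {y} x≉0 xy≈0 with inverse x x≉0
  ... | x⁻¹ , xx⁻¹≈1 = begin
    y                ≈⟨ *-identityˡ y ⟨
    1# * y           ≈⟨ *-congʳ xx⁻¹≈1 ⟨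
    (x * x⁻¹) * y    ≈⟨ *-congʳ (*-comm x x⁻¹) ⟩
    (x⁻¹ * x) * y    ≈⟨ *-assoc x⁻¹ x y ⟩
    x⁻¹ * (x * y)    ≈⟨ *-congˡ xy≈0 ⟩
    x⁻¹ * 0#         ≈⟨ zeroʳ x⁻¹ ⟩
    0#               ∎

  self-negative⇒0 : CharNot2 → ∀ {x} → x ≈ - x → x ≈ 0#
  self-negative⇒0 char≠2 {x} x≈-x = cancel char≠2 (begin
    (1# + 1#) * x    ≈⟨ solve 1 (λ x → (con (+ 1) :+ con (+ 1)) :* x := x :+ x) refl x ⟩
    x + x            ≈⟨ +-congˡ x≈-x ⟩
    x + - x          ≈⟨ -‿inverseʳ x ⟩
    0#               ∎)

  skew-η : CharNot2 → (A : Matrix 3) → SkewSymmetric A → ∀ {a b c} →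
           A zero (suc zero) ≈ a → A zero (suc (suc zero)) ≈ b → A (suc zero) (suc (suc zero)) ≈ c →
           A ≐ skew3 0# -_ a b c
  skew-η ch A sk a≈ b≈ c≈ zero             zero             = self-negative⇒0 ch (sk zero zero)
  skew-η ch A sk a≈ b≈ c≈ zero             (suc zero)       = a≈
  skew-η ch A sk a≈ b≈ c≈ zero             (suc (suc zero)) = b≈
  skew-η ch A sk a≈ b≈ c≈ (suc zero)       zero             = trans (sk zero (suc zero)) (-‿cong a≈)
  skew-η ch A sk a≈ b≈ c≈ (suc zero)       (suc zero)       = self-negative⇒0 ch (sk (suc zero) (suc zero))
  skew-η ch A sk a≈ b≈ c≈ (suc zero)       (suc (suc zero)) = c≈
  skew-η ch A sk a≈ b≈ c≈ (suc (suc zero)) zero             = trans (sk zero (suc (suc zero))) (-‿cong b≈)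
  skew-η ch A sk a≈ b≈ c≈ (suc (suc zero)) (suc zero)       = trans (sk (suc zero) (suc (suc zero))) (-‿cong c≈)
  skew-η ch A sk a≈ b≈ c≈ (suc (suc zero)) (suc (suc zero)) = self-negative⇒0 ch (sk (suc (suc zero)) (suc (suc zero)))

  det-skew^∞ : CharNot2 → (A : Matrix 3) → SkewSymmetric A → ∀ {a b c} →
               A zero (suc zero) ≈ a → A zero (suc (suc zero)) ≈ b → A (suc zero) (suc (suc zero)) ≈ c →
               det 4 (A ^∞) ≈ sq (a - b + c)
  det-skew^∞ ch A sk a≈ b≈ c≈ = trans (det-cong 4 (^∞-cong (skew-η ch A sk a≈ b≈ c≈))) (det-skew3^∞ _ _ _)

  square-cancellation : CharNot2 → ∀ {a b c} → ¬ (a ≈ 0#) →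
                    sq (a - b + c) ≈ sq (a - - b + - c) → c ≈ b
  square-cancellation ch {a} {b} {c} a≉0 sq≈sq =
    x∙y⁻¹≈ε⇒x≈y c b (cancel a≉0 (cancel ch (cancel ch four-a[c-b]≈0)))
    where
    difference : sq (a - b + c) - sq (a - - b + - c) ≈ (1# + 1#) * ((1# + 1#) * (a * (c - b)))
    difference = solve 3 (λ a b c →
      (a :- b :+ c) :* (a :- b :+ c) :- (a :- :- b :+ :- c) :* (a :- :- b :+ :- c)
        := (con (+ 1) :+ con (+ 1)) :* ((con (+ 1) :+ con (+ 1)) :* (a :* (c :- b)))) refl a b c

    four-a[c-b]≈0 : (1# + 1#) * ((1# + 1#) * (a * (c - b))) ≈ 0#
    four-a[c-b]≈0 = trans (sym difference) (x≈y⇒x∙y⁻¹≈ε sq≈sq)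

lemma5 : ∀ {c ℓ} (K : Field c ℓ) → let open FieldDefs K in
         CharNot2 →
         ∀ (A B : Matrix 3) →
         SkewSymmetric A → Dense A → SkewSymmetric B → Dense B →
         A zero (suc zero) ≈ B zero (suc zero) →
         A (suc (suc zero)) zero ≈ B zero (suc (suc zero)) →
         A (suc (suc zero)) (suc zero) ≈ B (suc zero) (suc (suc zero)) →
         det 4 (A ^∞) ≈ det 4 (B ^∞) →
         (A zero (suc (suc zero)) ≈ A (suc zero) (suc (suc zero)))
           × (B zero (suc (suc zero)) ≈ B (suc zero) (suc (suc zero)))
lemma5 K ch A B skA denseA skB _ a≈ b′≈ c′≈ detA≈detB = sym c≈b , B₀₂≈B₁₂
  where
  open FieldDefs K
  open SkewDeterminants K
  open Field K using (_-_; refl; sym; trans; -‿cong)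
  a b c : Carrier
  a = A zero (suc zero)
  b = A zero (suc (suc zero))
  c = A (suc zero) (suc (suc zero))

  B₀₂≈-b : B zero (suc (suc zero)) ≈ - b
  B₀₂≈-b = trans (sym b′≈) (skA zero (suc (suc zero)))

  B₁₂≈-c : B (suc zero) (suc (suc zero)) ≈ - c
  B₁₂≈-c = trans (sym c′≈) (skA (suc zero) (suc (suc zero)))

  sq≈sq : sq (a - b + c) ≈ sq (a - - b + - c)
  sq≈sq = trans (sym (det-skew^∞ ch A skA refl refl refl))
         (trans detA≈detB (det-skew^∞ ch B skB (sym a≈) B₀₂≈-b B₁₂≈-c))

  c≈b : c ≈ b
  c≈b = square-cancellation ch (denseA zero (suc zero) (λ ())) sq≈sq

  B₀₂≈B₁₂ : B zero (suc (suc zero)) ≈ B (suc zero) (suc (suc zero))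
  B₀₂≈B₁₂ = trans B₀₂≈-b (trans (-‿cong (sym c≈b)) (sym B₁₂≈-c))
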